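{- Let \(\Pi\) be a derivation in the system \(\mathrm{HA}+\mathrm{EM}_1\) described in the context, with no free term variables. Assume that \(\Pi\) ends with an \(\mathrm{EM}_1\) rule instance whose conclusion is an occurrence of a simple formula, and that the derivation of the leftmost premiss of this instance has a principal branch in open normal form. Then at least one of the following holds: (1) \(\Pi\) has a head-cut or a non-normal term along a principal branch; (2) \(\Pi\) has a principal branch in open normal form.
   Context: The system \(\mathrm{HA}+\mathrm{EM}_1\) is a natural deduction system for first-order Heyting arithmetic. Language: variables for natural numbers, a function symbol for every primitive recursive function (including \(0\) and successor \(S\)), the equality predicate, and the \(0\)-ary predicate \(\bot\) (never true); \(\neg A\) abbreviates \(A \to \bot\). Terms are reduced by the defining equations of the primitive recursive functions oriented left to right; a term is normal if no such reduction applies to it; closed normal terms are numerals \(S^n(0)\), and formulas are identified when they have the same normal form. Rules: the usual introduction and elimination rule for each of \(\land, \lor, \to, \forall, \exists\) (minimal logic, with discharge of assumptions); atomic rules, i.e. a recursive, sound set of rules whose premisses and conclusion are atomic, which do not discharge assumptions nor bind variables, containing the equality rules, ex falso \(\bot / P\) for atomic \(P\), \(S(x)=0/\bot\), \(S(x)=S(y)/x=y\), and, for every closed atomic \(P\), the axiom \(/P\) if \(P\) is true and the rule \(P/\bot\) if \(P\) is false; the induction rule Ind: from \(A[0/x]\) and a derivation of \(A[S(x)/x]\) from the discharged assumption \(A\), conclude \(A[t/x]\) (\(t\) is the main term); and the rule \(\mathrm{EM}_1\): for an atomic formula \(P\), from a derivation of \(C\) from the discharged assumption \(\forall x P\) (the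 universal assumption) and a derivation of \(C\) from the discharged assumption \(\neg P[y/x]\) (the existential assumption), where \(y\) does not occur in \(C\) nor in open assumptions other than \(\neg P[y/x]\), conclude \(C\). Ind and \(\mathrm{EM}_1\) are counted as neither introduction nor elimination rules. In an elimination rule the major premiss is the one containing the eliminated connective/quantifier, displayed leftmost; for \(\mathrm{EM}_1\) the leftmost premiss is the major one. Derivations are trees of formula occurrences. A rule instance binds a term variable as follows: \(\forall\)I binds its quantified variable in the derivation of its premiss; \(\exists\)E binds its eigenvariable in the derivation of its rightmost premiss; Ind binds \(x\) in the derivation of its rightmost premiss; \(\mathrm{EM}_1\) binds \(y\) in the derivation of its rightmost premiss. A term variable is free in a derivation if it occurs free in some formula occurrence and is not bound by any rule instance. A branch of a derivation \(\Pi\) is a sequence of formula occurrences \(\mathfrak{a}_0,\dotsc,\mathfrak{a}_n\) such that \(\mathfrak{a}_0\) is an assumption or the conclusion of an atomic axiom, \(\mathfrak{a}_i\) is a premiss and \(\mathfrak{a}_{i+1}\) the conclusion of one rule instance \(r_{i+1}\), and \(\mathfrak{a}_n\) is the conclusion of \(\Pi\). It is principal if whenever \(\mathfrak{a}_i\) is a premiss of an elimination or \(\mathrm{EM}_1\) rule instance, it is its major (leftmost) premiss. A principal branch has a non-normal term if some formula occurrence on it contains a non-normal term. The head-cut of a principal branch \(\mathfrak{a}_0,\dotsc,\mathfrak{a}_n\) is the \(\mathfrak{a}_i\) with maximal \(i\) such that one of the following holds (if such \(i\) exists, there is a head-cut along the branch): (a) \(\mathfrak{a}_i\) is the conclusion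 of an elimination rule instance whose major premiss \(\mathfrak{a}_{i-1}\) is the conclusion of an introduction rule instance, and when the latter is a \(\land\)I instance, \(\mathfrak{a}_{i-2}\) is an occurrence of the same formula as \(\mathfrak{a}_i\); (b) \(\mathfrak{a}_i\) is the conclusion of an Ind instance whose main term is \(0\) or \(S(s)\) for some term \(s\); (c) \(\mathfrak{a}_i\) is the conclusion of an \(\mathrm{EM}_1\) instance \(r\) and either \(\mathfrak{a}_{i-1}\) is derived without using the assumption discharged by \(r\), or \(\mathfrak{a}_0\) is an occurrence of the universal assumption discharged by \(r\) and \(\mathfrak{a}_1\) is an occurrence of a closed atomic formula; (d) \(\mathfrak{a}_i\) is the conclusion of an elimination rule instance and \(\mathfrak{a}_{i-1}\) is the conclusion of an \(\mathrm{EM}_1\) instance. A principal branch \(\mathfrak{a}_0,\dotsc,\mathfrak{a}_n\) is in open normal form if there are natural numbers \(n_E,n_A,n_I\) with \(n_E+n_A+n_I=n\) such that: \(\mathfrak{a}_0\) is an open assumption of the derivation; \(\mathfrak{a}_i\) is the conclusion of an elimination rule instance for \(0<i\le n_E\); \(\mathfrak{a}_i\) is the conclusion of an atomic or \(\mathrm{EM}_1\) rule instance for \(n_E<i\le n_E+n_A\); \(\mathfrak{a}_{n_E+n_A+1}\) is the conclusion of an introduction rule instance; and \(\mathfrak{a}_i\) is the conclusion of an introduction or \(\mathrm{EM}_1\) rule instance for \(n_E+n_A<i\le n\). A formula is simply existential (resp. simply universal) if it is \(\exists x P\) (resp. \(\forall x P\)) with \(P\) atomic; it is simple if it is closed and either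 atomic or simply existential. -}

module Defs where

open import Data.Nat using (ℕ; zero; suc; _+_; _<_; _∸_; _≡ᵇ_)
open import Data.Fin using (Fin; toℕ)
open import Data.Vec as Vec using (Vec; []; _∷_)
open import Data.List as List using (List; []; _∷_; _++_; length)
open import Data.List.Relation.Unary.All using (All)
open import Data.List.Relation.Binary.Pointwise using (Pointwise)
open import Data.Maybe using (Maybe; just; nothing)
open import Data.Product using (Σ; ∃; ∃₂; _×_; _,_; proj₁)
open import Data.Sum using (_⊎_)
open import Data.Empty using (⊥)
open import Data.Unit using (⊤)
open import Data.Bool using (if_then_else_)
open import Relation.Nullary using (¬_; Dec)
open import Relation.Binary.PropositionalEquality using (_≡_)
open import Relation.Binary.Construct.Closure.ReflexiveTransitive using (Star)

data PR : ℕ → Set where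
  zeroᶠ : PR 0
  succᶠ : PR 1
  projᶠ : ∀ {n} → Fin n → PR n
  compᶠ : ∀ {n m} → PR m → Vec (PR n) m → PR n
  recᶠ  : ∀ {n} → PR n → PR (suc (suc n)) → PR (suc n)

data Term : Set where
  var : ℕ → Term
  app : ∀ {n} → PR n → Vec Term n → Term

Z : Term
Z = app zeroᶠ []

S : Term → Term
S t = app succᶠ (t ∷ [])

data _⊑_ (s : Term) : Term → Set
data _⊑ᵛ_ (s : Term) : ∀ {n} → Vec Term n → Set

data _⊑_ s where
  ⊑-refl : s ⊑ s
  ⊑-app  : ∀ {n} {f : PR n} {ts} → s ⊑ᵛ ts → s ⊑ app f ts

data _⊑ᵛ_ s where
  here  : ∀ {n t} {ts : Vec Term n} → s ⊑ t → s ⊑ᵛ (t ∷ ts)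
  there : ∀ {n t} {ts : Vec Term n} → s ⊑ᵛ ts → s ⊑ᵛ (t ∷ ts)

_∈t_ : ℕ → Term → Set
x ∈t t = var x ⊑ t

substT  : Term → Term → ℕ → Term
substTs : ∀ {n} → Vec Term n → Term → ℕ → Vec Term n
substT (var y) s x = if x ≡ᵇ y then s else var y
substT (app f ts) s x = app f (substTs ts s x)
substTs [] s x = []
substTs (t ∷ ts) s x = substT t s x ∷ substTs ts s x

data _⟶_ : Term → Term → Set
data _⟶ᵛ_ : ∀ {n} → Vec Term n → Vec Term n → Set

data _⟶_ where
  proj-β : ∀ {n} (i : Fin n) (ts : Vec Term n) →
           app (projᶠ i) ts ⟶ Vec.lookup ts i
  comp-β : ∀ {n m} (f : PR m) (gs : Vec (PR n) m) (ts : Vec Term n) →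
           app (compᶠ f gs) ts ⟶ app f (Vec.map (λ g → app g ts) gs)
  rec-0  : ∀ {n} (g : PR n) (h : PR (suc (suc n))) (ts : Vec Term n) →
           app (recᶠ g h) (Z ∷ ts) ⟶ app g ts
  rec-S  : ∀ {n} (g : PR n) (h : PR (suc (suc n))) (s : Term) (ts : Vec Term n) →
           app (recᶠ g h) (S s ∷ ts) ⟶ app h (s ∷ app (recᶠ g h) (s ∷ ts) ∷ ts)
  cong   : ∀ {n} (f : PR n) {ts us : Vec Term n} → ts ⟶ᵛ us → app f ts ⟶ app f us

data _⟶ᵛ_ where
  here  : ∀ {n t t'} {ts : Vec Term n} → t ⟶ t' → (t ∷ ts) ⟶ᵛ (t' ∷ ts)
  there : ∀ {n t} {ts ts' : Vec Term n} → ts ⟶ᵛ ts' → (t ∷ ts) ⟶ᵛ (t ∷ ts')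

Normal : Term → Set
Normal t = ∀ u → ¬ (t ⟶ u)

data Formula : Set where
  _≐_    : Term → Term → Formula
  falsum : Formula
  and or imp : Formula → Formula → Formula
  all ex : ℕ → Formula → Formula

neg : Formula → Formula
neg A = imp A falsum

Atomic : Formula → Set
Atomic (_ ≐ _) = ⊤
Atomic falsum  = ⊤
Atomic _       = ⊥

_∈F_ : ℕ → Formula → Set
x ∈F (t ≐ u)   = x ∈t t ⊎ x ∈t u
x ∈F falsum    = ⊥
x ∈F and A B   = x ∈F A ⊎ x ∈F B
x ∈F or A B    = x ∈F A ⊎ x ∈F B
x ∈F imp A B   = x ∈F A ⊎ x ∈F B
x ∈F all y A   = ¬ (x ≡ y) × x ∈F A
x ∈F ex y A    = ¬ (x ≡ y) × x ∈F A

Closed : Formula → Set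
Closed A = ∀ x → ¬ (x ∈F A)

_⊑F_ : Term → Formula → Set
s ⊑F (t ≐ u)  = s ⊑ t ⊎ s ⊑ u
s ⊑F falsum   = ⊥
s ⊑F and A B  = s ⊑F A ⊎ s ⊑F B
s ⊑F or A B   = s ⊑F A ⊎ s ⊑F B
s ⊑F imp A B  = s ⊑F A ⊎ s ⊑F B
s ⊑F all _ A  = s ⊑F A
s ⊑F ex _ A   = s ⊑F A

-- substitution A[s/x] (only used under the side condition FreeFor s x A)
substF : Formula → Term → ℕ → Formula
substF (t ≐ u) s x  = substT t s x ≐ substT u s x
substF falsum s x   = falsum
substF (and A B) s x = and (substF A s x) (substF B s x)
substF (or A B) s x  = or (substF A s x) (substF B s x)
substF (imp A B) s x = imp (substF A s x) (substF B s x)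
substF (all y A) s x = if y ≡ᵇ x then all y A else all y (substF A s x)
substF (ex y A) s x  = if y ≡ᵇ x then ex y A else ex y (substF A s x)

FreeFor : Term → ℕ → Formula → Set
FreeFor s x (_ ≐ _)   = ⊤
FreeFor s x falsum    = ⊤
FreeFor s x (and A B) = FreeFor s x A × FreeFor s x B
FreeFor s x (or A B)  = FreeFor s x A × FreeFor s x B
FreeFor s x (imp A B) = FreeFor s x A × FreeFor s x B
FreeFor s x (all y A) = ¬ (x ∈F all y A) ⊎ (¬ (y ∈t s) × FreeFor s x A)
FreeFor s x (ex y A)  = ¬ (x ∈F ex y A) ⊎ (¬ (y ∈t s) × FreeFor s x A)

data _⟶F_ : Formula → Formula → Set where
  eqL  : ∀ {t t' u} → t ⟶ t' → (t ≐ u) ⟶F (t' ≐ u)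
  eqR  : ∀ {t u u'} → u ⟶ u' → (t ≐ u) ⟶F (t ≐ u')
  andL : ∀ {A A' B} → A ⟶F A' → and A B ⟶F and A' B
  andR : ∀ {A B B'} → B ⟶F B' → and A B ⟶F and A B'
  orL  : ∀ {A A' B} → A ⟶F A' → or A B ⟶F or A' B
  orR  : ∀ {A B B'} → B ⟶F B' → or A B ⟶F or A B'
  impL : ∀ {A A' B} → A ⟶F A' → imp A B ⟶F imp A' B
  impR : ∀ {A B B'} → B ⟶F B' → imp A B ⟶F imp A B'
  allS : ∀ {x A A'} → A ⟶F A' → all x A ⟶F all x A'
  exS  : ∀ {x A A'} → A ⟶F A' → ex x A ⟶F ex x A'

NormalF : Formula → Set
NormalF A = ∀ B → ¬ (A ⟶F B)

-- formulas are identified when they have the same normal form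
_≈_ : Formula → Formula → Set
A ≈ B = ∃ λ C → Star _⟶F_ A C × Star _⟶F_ B C × NormalF C

SimplyExistential : Formula → Set
SimplyExistential A = ∃₂ λ x P → A ≡ ex x P × Atomic P

Simple : Formula → Set
Simple A = Closed A × (Atomic A ⊎ SimplyExistential A)

evalPR  : ∀ {n} → PR n → Vec ℕ n → ℕ
evalPRs : ∀ {n m} → Vec (PR n) m → Vec ℕ n → Vec ℕ m
evalRec : ∀ {n} → PR n → PR (suc (suc n)) → ℕ → Vec ℕ n → ℕ
evalPR zeroᶠ [] = 0
evalPR succᶠ (m ∷ []) = suc m
evalPR (projᶠ i) v = Vec.lookup v i
evalPR (compᶠ f gs) v = evalPR f (evalPRs gs v)
evalPR (recᶠ g h) (m ∷ v) = evalRec g h m v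
evalPRs [] v = []
evalPRs (g ∷ gs) v = evalPR g v ∷ evalPRs gs v
evalRec g h zero v = evalPR g v
evalRec g h (suc m) v = evalPR h (m ∷ evalRec g h m v ∷ v)

evalT  : (ℕ → ℕ) → Term → ℕ
evalTs : ∀ {n} → (ℕ → ℕ) → Vec Term n → Vec ℕ n
evalT ρ (var x) = ρ x
evalT ρ (app f ts) = evalPR f (evalTs ρ ts)
evalTs ρ [] = []
evalTs ρ (t ∷ ts) = evalT ρ t ∷ evalTs ρ ts

-- truth of an atomic formula under an assignment (non-atomic formulas: ⊥, never used)
Holds : (ℕ → ℕ) → Formula → Set
Holds ρ (t ≐ u) = evalT ρ t ≡ evalT ρ u
Holds ρ _       = ⊥

True : Formula → Set
True = Holds (λ _ → 0)

record AtomicRules : Set₁ where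
  field
    Rule      : List Formula → Formula → Set
    recursive : ∀ Ps C → Dec (Rule Ps C)
    atomic    : ∀ {Ps C} → Rule Ps C → All Atomic Ps × Atomic C
    sound     : ∀ {Ps C} (ρ : ℕ → ℕ) → Rule Ps C → All (Holds ρ) Ps → Holds ρ C
    eq-refl   : ∀ t → Rule [] (t ≐ t)
    eq-repl   : ∀ s t x P → Atomic P → Rule ((s ≐ t) ∷ substF P s x ∷ []) (substF P t x)
    efq       : ∀ P → Atomic P → Rule (falsum ∷ []) P
    S≠0       : ∀ t → Rule ((S t ≐ Z) ∷ []) falsum
    S-inj     : ∀ s t → Rule ((S s ≐ S t) ∷ []) (s ≐ t)
    true-ax   : ∀ P → Atomic P → Closed P → True P → Rule [] P
    false-r   : ∀ P → Atomic P → Closed P → ¬ True P → Rule (P ∷ []) falsum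

open AtomicRules public

-- Derivations: trees of formula occurrences. Each node stores its
-- conclusion (first argument) and the data of the rule instance.
-- Assumptions carry a discharge label.

data Der : Set where
  hyp  : (u : ℕ) → Formula → Der
  atm  : Formula → List Der → Der
  andI : Formula → Der → Der → Der
  andE₁ andE₂ : Formula → Der → Der
  orI₁ orI₂   : Formula → Der → Der
  orE  : Formula → (u v : ℕ) (A B : Formula) → Der → Der → Der → Der
  impI : Formula → (u : ℕ) (A : Formula) → Der → Der
  impE : Formula → Der → Der → Der
  allI : Formula → (x : ℕ) → Der → Der
  allE : Formula → (x : ℕ) (A : Formula) (t : Term) → Der → Der
  exI  : Formula → (x : ℕ) (A : Formula) (t : Term) → Der → Der
  exE  : Formula → (x y u : ℕ) (A : Formula) → Der → Der → Der   -- eigenvariable y, assumption u : A[y/x]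
  ind  : Formula → (x u : ℕ) (A : Formula) (t : Term) → Der → Der → Der
  em1  : Formula → (P : Formula) (x y u v : ℕ) → Der → Der → Der
         -- u : ∀x P (universal assumption), v : ¬ P[y/x] (existential assumption)

concl : Der → Formula
concl (hyp _ A) = A
concl (atm C _) = C
concl (andI C _ _) = C
concl (andE₁ C _) = C
concl (andE₂ C _) = C
concl (orI₁ C _) = C
concl (orI₂ C _) = C
concl (orE C _ _ _ _ _ _ _) = C
concl (impI C _ _ _) = C
concl (impE C _ _) = C
concl (allI C _ _) = C
concl (allE C _ _ _ _) = C
concl (exI C _ _ _ _) = C
concl (exE C _ _ _ _ _ _) = C
concl (ind C _ _ _ _ _ _) = C
concl (em1 C _ _ _ _ _ _ _) = C

-- premisses, left to right (the leftmost is the major one)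
prems : Der → List Der
prems (hyp _ _) = []
prems (atm _ ds) = ds
prems (andI _ d e) = d ∷ e ∷ []
prems (andE₁ _ d) = d ∷ []
prems (andE₂ _ d) = d ∷ []
prems (orI₁ _ d) = d ∷ []
prems (orI₂ _ d) = d ∷ []
prems (orE _ _ _ _ _ d e f) = d ∷ e ∷ f ∷ []
prems (impI _ _ _ d) = d ∷ []
prems (impE _ d e) = d ∷ e ∷ []
prems (allI _ _ d) = d ∷ []
prems (allE _ _ _ _ d) = d ∷ []
prems (exI _ _ _ _ d) = d ∷ []
prems (exE _ _ _ _ _ d e) = d ∷ e ∷ []
prems (ind _ _ _ _ _ d e) = d ∷ e ∷ []
prems (em1 _ _ _ _ _ _ d e) = d ∷ e ∷ []

dis : Der → ℕ → Maybe (ℕ × Formula)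
dis (orE _ u v A B _ _ _) 1 = just (u , A)
dis (orE _ u v A B _ _ _) 2 = just (v , B)
dis (impI _ u A _) 0 = just (u , A)
dis (exE _ x y u A _ _) 1 = just (u , substF A (var y) x)
dis (ind _ x u A _ _ _) 1 = just (u , A)
dis (em1 _ P x y u v _ _) 0 = just (u , all x P)
dis (em1 _ P x y u v _ _) 1 = just (v , neg (substF P (var y) x))
dis _ _ = nothing

Kills : Der → ℕ → ℕ → Formula → Set
Kills d k u B = ∃ λ A → dis d k ≡ just (u , A) × B ≈ A

binds : Der → ℕ → Maybe ℕ
binds (allI _ x _) 0 = just x
binds (exE _ x y u A _ _) 1 = just y
binds (ind _ x u A t _ _) 1 = just x
binds (em1 _ P x y u v _ _) 1 = just y
binds _ _ = nothing

IsIntro IsElim IsAtomicRule IsEM1 IsAndI : Der → Set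
IsIntro (andI _ _ _) = ⊤
IsIntro (orI₁ _ _) = ⊤
IsIntro (orI₂ _ _) = ⊤
IsIntro (impI _ _ _ _) = ⊤
IsIntro (allI _ _ _) = ⊤
IsIntro (exI _ _ _ _ _) = ⊤
IsIntro _ = ⊥
IsElim (andE₁ _ _) = ⊤
IsElim (andE₂ _ _) = ⊤
IsElim (orE _ _ _ _ _ _ _ _) = ⊤
IsElim (impE _ _ _) = ⊤
IsElim (allE _ _ _ _ _) = ⊤
IsElim (exE _ _ _ _ _ _ _) = ⊤
IsElim _ = ⊥
IsAtomicRule (atm _ _) = ⊤
IsAtomicRule _ = ⊥
IsEM1 (em1 _ _ _ _ _ _ _ _) = ⊤
IsEM1 _ = ⊥
IsAndI (andI _ _ _) = ⊤
IsAndI _ = ⊥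

IndCanonical : Der → Set
IndCanonical (ind _ _ _ _ t _ _) = t ≡ Z ⊎ ∃ λ s → t ≡ S s
IndCanonical _ = ⊥

IsLeaf : Der → Set
IsLeaf (hyp _ _) = ⊤
IsLeaf (atm _ []) = ⊤
IsLeaf _ = ⊥

data Pos : Der → Set where
  here  : ∀ {d} → Pos d
  there : ∀ {d} (k : Fin (length (prems d))) → Pos (List.lookup (prems d) k) → Pos d

target : ∀ {d} → Pos d → Der
target {d} here = d
target (there k p) = target p

-- the occurrences from the position down to the root: element i is
-- (dᵢ , kᵢ) where dᵢ is the subderivation concluding 𝔞ᵢ and 𝔞ᵢ₋₁ is
-- the kᵢ-th premiss of dᵢ (k₀ = 0 is irrelevant)
chain : ∀ {d} → Pos d → List (Der × ℕ)
chain {d} here = (d , 0) ∷ []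
chain {d} (there k p) = chain p ++ ((d , toℕ k) ∷ [])

_‼_ : ∀ {A : Set} → List A → ℕ → Maybe A
[] ‼ _ = nothing
(a ∷ as) ‼ zero = just a
(a ∷ as) ‼ suc i = as ‼ i

Undischarged : List (Der × ℕ) → ℕ → Formula → Set
Undischarged ch u B = ∀ i d k → 0 < i → ch ‼ i ≡ just (d , k) → ¬ Kills d k u B

OpenHyp : Der → ℕ → Formula → Set
OpenHyp d u B = Σ (Pos d) λ p → target p ≡ hyp u B × Undischarged (chain p) u B

NoFreeVars : Der → Set
NoFreeVars d = ∀ (p : Pos d) x → x ∈F concl (target p) →
  ∃ λ i → ∃₂ λ d' k → 0 < i × chain p ‼ i ≡ just (d' , k) × binds d' k ≡ just x

Branch : Der → Set
Branch d = Σ (Pos d) λ p → IsLeaf (target p)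

chainB : ∀ {d} → Branch d → List (Der × ℕ)
chainB b = chain (proj₁ b)

Principal : ∀ {d} → Branch d → Set
Principal b = ∀ i d k → 0 < i → chainB b ‼ i ≡ just (d , k) →
  IsElim d ⊎ IsEM1 d → k ≡ 0

HasNonNormal : ∀ {d} → Branch d → Set
HasNonNormal b = ∃ λ i → ∃₂ λ d k → chainB b ‼ i ≡ just (d , k) ×
  ∃ λ s → s ⊑F concl d × ¬ Normal s

-- head-cut at position i = suc j ; d = dᵢ, d' = dᵢ₋₁
module _ (ch : List (Der × ℕ)) (j : ℕ) (d : Der) (k : ℕ) (d' : Der) (k' : ℕ) where
  CutA : Set
  CutA = IsElim d × k ≡ 0 × IsIntro d' ×
    (IsAndI d' → ∃ λ j' → j ≡ suc j' × ∃₂ λ d'' k'' →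
       ch ‼ j' ≡ just (d'' , k'') × concl d'' ≈ concl d)

  CutB : Set
  CutB = IndCanonical d

  CutC : Set
  CutC = IsEM1 d ×
    ( (¬ ∃₂ λ u B → OpenHyp d' u B × Kills d k u B)
    ⊎ (∃₂ λ u B → ch ‼ 0 ≡ just (hyp u B , 0) × k ≡ 0 × Kills d 0 u B ×
         (∀ j' d'' k'' → 0 < j' → j' < suc j → ch ‼ j' ≡ just (d'' , k'') → ¬ Kills d'' k'' u B) ×
         ∃₂ λ d₁ k₁ → ch ‼ 1 ≡ just (d₁ , k₁) × Closed (concl d₁) × Atomic (concl d₁)))

  CutD : Set
  CutD = IsElim d × IsEM1 d'

HasHeadCut : ∀ {d} → Branch d → Set
HasHeadCut b = ∃ λ j → ∃₂ λ d k → ∃₂ λ d' k' →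
  chainB b ‼ suc j ≡ just (d , k) × chainB b ‼ j ≡ just (d' , k') ×
  (CutA (chainB b) j d k d' k' ⊎ CutB (chainB b) j d k d' k' ⊎
   CutC (chainB b) j d k d' k' ⊎ CutD (chainB b) j d k d' k')

OpenNormalForm : ∀ {d} → Branch d → Set
OpenNormalForm b =
  ∃ λ nE → ∃₂ λ nA nI → nE + nA + nI ≡ length ch ∸ 1 ×
  (∃₂ λ u B → ch ‼ 0 ≡ just (hyp u B , 0) × Undischarged ch u B) ×
  (∀ i d k → 0 < i → i ≤ nE → ch ‼ i ≡ just (d , k) → IsElim d) ×
  (∀ i d k → nE < i → i ≤ nE + nA → ch ‼ i ≡ just (d , k) → IsAtomicRule d ⊎ IsEM1 d) ×
  (∀ d k → ch ‼ suc (nE + nA) ≡ just (d , k) → IsIntro d) ×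
  (∀ i d k → nE + nA < i → ch ‼ i ≡ just (d , k) → IsIntro d ⊎ IsEM1 d)
  where
  open import Data.Nat using (_≤_)
  ch = chainB b

module _ (R : AtomicRules) where
  WF  : Der → Set
  WFs : List Der → Set
  WFs [] = ⊤
  WFs (d ∷ ds) = WF d × WFs ds
  WF (hyp u A) = ⊤
  WF (atm C ds) =
    (∃₂ λ Ps C' → Pointwise _≈_ (List.map concl ds) Ps × C ≈ C' × Rule R Ps C') × WFs ds
  WF (andI C d e) = C ≈ and (concl d) (concl e) × WF d × WF e
  WF (andE₁ C d) = (∃ λ B → concl d ≈ and C B) × WF d
  WF (andE₂ C d) = (∃ λ A → concl d ≈ and A C) × WF d
  WF (orI₁ C d) = (∃ λ B → C ≈ or (concl d) B) × WF d
  WF (orI₂ C d) = (∃ λ A → C ≈ or A (concl d)) × WF d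
  WF (orE C u v A B d e f) =
    concl d ≈ or A B × concl e ≈ C × concl f ≈ C × WF d × WF e × WF f
  WF (impI C u A d) = C ≈ imp A (concl d) × WF d
  WF (impE C d e) = concl d ≈ imp (concl e) C × WF d × WF e
  WF (allI C x d) =
    C ≈ all x (concl d) × (∀ u B → OpenHyp d u B → ¬ (x ∈F B)) × WF d
  WF (allE C x A t d) =
    concl d ≈ all x A × FreeFor t x A × C ≈ substF A t x × WF d
  WF (exI C x A t d) =
    C ≈ ex x A × FreeFor t x A × concl d ≈ substF A t x × WF d
  WF (exE C x y u A d e) =
    concl d ≈ ex x A × concl e ≈ C × FreeFor (var y) x A ×
    ¬ (y ∈F ex x A) × ¬ (y ∈F C) ×
    (∀ w B → OpenHyp e w B → ¬ Kills (exE C x y u A d e) 1 w B → ¬ (y ∈F B)) ×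
    WF d × WF e
  WF (ind C x u A t d e) =
    concl d ≈ substF A Z x × concl e ≈ substF A (S (var x)) x ×
    C ≈ substF A t x × FreeFor t x A ×
    (∀ w B → OpenHyp e w B → ¬ Kills (ind C x u A t d e) 1 w B → ¬ (x ∈F B)) ×
    WF d × WF e
  WF (em1 C P x y u v d e) =
    Atomic P × concl d ≈ C × concl e ≈ C × ¬ (y ∈F C) ×
    (∀ w B → OpenHyp e w B → ¬ Kills (em1 C P x y u v d e) 1 w B → ¬ (y ∈F B)) ×
    WF d × WF e

-- Extend the given branch by the final EM₁ instance; it stays principal. Whether EM₁ discharges
-- the assumption at the top of the branch is decidable, since formulas are identified exactly
-- when their normal forms coincide. If it does not, the extension is again in open normal form,
-- EM₁ joining the atomic part when the introduction part is empty and the introduction part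
-- otherwise. If it does, that assumption is ∀x P with P atomic. Going up from the simple
-- conclusion, introductions and major premisses of EM₁ keep the formula atomic or simply
-- existential, while going down from the assumption, atomic rules and EM₁ keep it universal;
-- so the elimination part is not empty. Its first rule is then ∀E concluding an atomic formula,
-- closed since no rule on the branch binds a variable: a head-cut of kind (c) at the root.
module Submission where

open import Defs
open import Data.Nat as ℕ using (ℕ; zero; suc; _+_; _∸_; _<_; _≤_; z≤n; s≤s)
open import Data.Nat.Properties
  using ( <-irrefl; suc-injective; 1+n≰n; 1+n≢n; <⇒≤; +-comm; +-identityʳ; +-suc; m+[n∸m]≡n; m<m+n
        ; m≤n⇒m≤1+n; ≤-pred; ≤-trans; ≤-refl; m≤m+n; <-trans; n<1+n; n≤1+n; n≢0⇒n>0; ≰⇒>; _≤?_)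
open import Data.Fin as Fin using (toℕ)
open import Data.Vec as Vec using (Vec; []; _∷_)
open import Data.List as List using (List; []; _∷_; _∷ʳ_; length)
open import Data.List.Properties using (length-++)
open import Data.List.Relation.Unary.All using (All; []; _∷_)
open import Data.List.Relation.Binary.Pointwise using (Pointwise; []; _∷_)
open import Data.Maybe using (just; nothing)
open import Data.Maybe.Properties using (just-injective)
open import Data.Product using (Σ; ∃; ∃₂; _×_; _,_; proj₁; proj₂)
open import Data.Sum as Sum using (_⊎_; inj₁; inj₂)
open import Data.Empty using (⊥; ⊥-elim)
open import Data.Unit using (⊤; tt)
open import Relation.Nullary using (¬_; Dec; yes; no)
open import Relation.Binary.Definitions using (DecidableEquality)
open import Relation.Binary.PropositionalEquality as ≡ using (_≡_; refl; sym; trans)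
open import Relation.Binary.Construct.Closure.ReflexiveTransitive using (Star; ε; _◅_; _◅◅_; gmap)

-- Normal forms

_⟶*_ : Term → Term → Set
_⟶*_ = Star _⟶_

_⟶ᵛ*_ : ∀ {n} → Vec Term n → Vec Term n → Set
_⟶ᵛ*_ = Star _⟶ᵛ_

_⟶F*_ : Formula → Formula → Set
_⟶F*_ = Star _⟶F_

-- reduceApp f ts is the normal form of app f ts when the ts are normal.
reduceApp  : ∀ {n} → PR n → Vec Term n → Term
reduceApps : ∀ {n m} → Vec (PR n) m → Vec Term n → Vec Term m
reduceRec  : ∀ {n} → PR n → PR (suc (suc n)) → Term → Vec Term n → Term
reduceApp zeroᶠ [] = Z
reduceApp succᶠ (t ∷ []) = S t
reduceApp (projᶠ i) ts = Vec.lookup ts i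
reduceApp (compᶠ f gs) ts = reduceApp f (reduceApps gs ts)
reduceApp (recᶠ g h) (t ∷ ts) = reduceRec g h t ts
reduceApps [] ts = []
reduceApps (g ∷ gs) ts = reduceApp g ts ∷ reduceApps gs ts
reduceRec g h (app zeroᶠ []) ts = reduceApp g ts
reduceRec g h (app succᶠ (s ∷ [])) ts = reduceApp h (s ∷ reduceRec g h s ts ∷ ts)
reduceRec g h t ts = app (recᶠ g h) (t ∷ ts)

nf  : Term → Term
nfs : ∀ {n} → Vec Term n → Vec Term n
nf (var x) = var x
nf (app f ts) = reduceApp f (nfs ts)
nfs [] = []
nfs (t ∷ ts) = nf t ∷ nfs ts

app-⟶* : ∀ {n} (f : PR n) {ts us} → ts ⟶ᵛ* us → app f ts ⟶* app f us
app-⟶* f = gmap (app f) (cong f)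

∷-⟶* : ∀ {n t t'} {ts ts' : Vec Term n} → t ⟶* t' → ts ⟶ᵛ* ts' → (t ∷ ts) ⟶ᵛ* (t' ∷ ts')
∷-⟶* t⟶*t' ts⟶*ts' = gmap _ here t⟶*t' ◅◅ gmap _ there ts⟶*ts'

reduceApp-⟶*  : ∀ {n} (f : PR n) ts → app f ts ⟶* reduceApp f ts
reduceApps-⟶* : ∀ {n m} (gs : Vec (PR n) m) ts → Vec.map (λ g → app g ts) gs ⟶ᵛ* reduceApps gs ts
reduceRec-⟶*  : ∀ {n} (g : PR n) h t ts → app (recᶠ g h) (t ∷ ts) ⟶* reduceRec g h t ts
reduceApp-⟶* zeroᶠ [] = ε
reduceApp-⟶* succᶠ (t ∷ []) = ε
reduceApp-⟶* (projᶠ i) ts = proj-β i ts ◅ ε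
reduceApp-⟶* (compᶠ f gs) ts = comp-β f gs ts ◅ app-⟶* f (reduceApps-⟶* gs ts) ◅◅ reduceApp-⟶* f _
reduceApp-⟶* (recᶠ g h) (t ∷ ts) = reduceRec-⟶* g h t ts
reduceApps-⟶* [] ts = ε
reduceApps-⟶* (g ∷ gs) ts = ∷-⟶* (reduceApp-⟶* g ts) (reduceApps-⟶* gs ts)
reduceRec-⟶* g h (app zeroᶠ []) ts = rec-0 g h ts ◅ reduceApp-⟶* g ts
reduceRec-⟶* g h (app succᶠ (s ∷ [])) ts =
  rec-S g h s ts ◅ app-⟶* h (∷-⟶* ε (∷-⟶* (reduceRec-⟶* g h s ts) ε)) ◅◅ reduceApp-⟶* h _
reduceRec-⟶* g h (var _) ts = ε
reduceRec-⟶* g h (app (projᶠ _) _) ts = ε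
reduceRec-⟶* g h (app (compᶠ _ _) _) ts = ε
reduceRec-⟶* g h (app (recᶠ _ _) _) ts = ε

nf-⟶*  : ∀ t → t ⟶* nf t
nfs-⟶* : ∀ {n} (ts : Vec Term n) → ts ⟶ᵛ* nfs ts
nf-⟶* (var x) = ε
nf-⟶* (app f ts) = app-⟶* f (nfs-⟶* ts) ◅◅ reduceApp-⟶* f _
nfs-⟶* [] = ε
nfs-⟶* (t ∷ ts) = ∷-⟶* (nf-⟶* t) (nfs-⟶* ts)

Normalᵛ : ∀ {n} → Vec Term n → Set
Normalᵛ ts = ∀ us → ¬ (ts ⟶ᵛ us)

Normalᵛ-head : ∀ {n t} {ts : Vec Term n} → Normalᵛ (t ∷ ts) → Normal t
Normalᵛ-head nv _ st = nv _ (here st)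

Normalᵛ-tail : ∀ {n t} {ts : Vec Term n} → Normalᵛ (t ∷ ts) → Normalᵛ ts
Normalᵛ-tail nv _ st = nv _ (there st)

Normalᵛ-∷ : ∀ {n t} {ts : Vec Term n} → Normal t → Normalᵛ ts → Normalᵛ (t ∷ ts)
Normalᵛ-∷ nt nts _ (here st) = nt _ st
Normalᵛ-∷ nt nts _ (there st) = nts _ st

Normalᵛ-[] : Normalᵛ []
Normalᵛ-[] _ ()

Normal-args : ∀ {n} {f : PR n} {ts} → Normal (app f ts) → Normalᵛ ts
Normal-args nt _ st = nt _ (cong _ st)

Normal-lookup : ∀ {n} (ts : Vec Term n) i → Normalᵛ ts → Normal (Vec.lookup ts i)
Normal-lookup (t ∷ ts) Fin.zero nv = Normalᵛ-head nv
Normal-lookup (t ∷ ts) (Fin.suc i) nv = Normal-lookup ts i (Normalᵛ-tail nv)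

Normal-reduceApp  : ∀ {n} (f : PR n) ts → Normalᵛ ts → Normal (reduceApp f ts)
Normalᵛ-reduceApps : ∀ {n m} (gs : Vec (PR n) m) ts → Normalᵛ ts → Normalᵛ (reduceApps gs ts)
Normal-reduceRec  : ∀ {n} (g : PR n) h t ts → Normal t → Normalᵛ ts → Normal (reduceRec g h t ts)
Normal-reduceApp zeroᶠ [] nv _ (cong _ ())
Normal-reduceApp succᶠ (t ∷ []) nv _ (cong _ st) = nv _ st
Normal-reduceApp (projᶠ i) ts nv = Normal-lookup ts i nv
Normal-reduceApp (compᶠ f gs) ts nv = Normal-reduceApp f _ (Normalᵛ-reduceApps gs ts nv)
Normal-reduceApp (recᶠ g h) (t ∷ ts) nv = Normal-reduceRec g h t ts (Normalᵛ-head nv) (Normalᵛ-tail nv)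
Normalᵛ-reduceApps [] ts nv = Normalᵛ-[]
Normalᵛ-reduceApps (g ∷ gs) ts nv = Normalᵛ-∷ (Normal-reduceApp g ts nv) (Normalᵛ-reduceApps gs ts nv)
Normal-reduceRec g h (app zeroᶠ []) ts nt nts = Normal-reduceApp g ts nts
Normal-reduceRec g h (app succᶠ (s ∷ [])) ts nt nts =
  Normal-reduceApp h _ (Normalᵛ-∷ ns (Normalᵛ-∷ (Normal-reduceRec g h s ts ns nts) nts))
  where ns = Normalᵛ-head (Normal-args nt)
Normal-reduceRec g h (var _) ts nt nts _ (cong _ (here st)) = nt _ st
Normal-reduceRec g h (var _) ts nt nts _ (cong _ (there st)) = nts _ st
Normal-reduceRec g h (app (projᶠ _) _) ts nt nts _ (cong _ (here st)) = nt _ st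
Normal-reduceRec g h (app (projᶠ _) _) ts nt nts _ (cong _ (there st)) = nts _ st
Normal-reduceRec g h (app (compᶠ _ _) _) ts nt nts _ (cong _ (here st)) = nt _ st
Normal-reduceRec g h (app (compᶠ _ _) _) ts nt nts _ (cong _ (there st)) = nts _ st
Normal-reduceRec g h (app (recᶠ _ _) _) ts nt nts _ (cong _ (here st)) = nt _ st
Normal-reduceRec g h (app (recᶠ _ _) _) ts nt nts _ (cong _ (there st)) = nts _ st

Normal-nf  : ∀ t → Normal (nf t)
Normalᵛ-nfs : ∀ {n} (ts : Vec Term n) → Normalᵛ (nfs ts)
Normal-nf (var x) _ ()
Normal-nf (app f ts) = Normal-reduceApp f _ (Normalᵛ-nfs ts)
Normalᵛ-nfs [] = Normalᵛ-[]
Normalᵛ-nfs (t ∷ ts) = Normalᵛ-∷ (Normal-nf t) (Normalᵛ-nfs ts)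

nfs-lookup : ∀ {n} (ts : Vec Term n) i → Vec.lookup (nfs ts) i ≡ nf (Vec.lookup ts i)
nfs-lookup (t ∷ ts) Fin.zero = refl
nfs-lookup (t ∷ ts) (Fin.suc i) = nfs-lookup ts i

nfs-map-app : ∀ {n m} (gs : Vec (PR n) m) ts →
  nfs (Vec.map (λ g → app g ts) gs) ≡ reduceApps gs (nfs ts)
nfs-map-app [] ts = refl
nfs-map-app (g ∷ gs) ts = ≡.cong (reduceApp g (nfs ts) ∷_) (nfs-map-app gs ts)

nf-resp-⟶   : ∀ {t t'} → t ⟶ t' → nf t ≡ nf t'
nfs-resp-⟶ᵛ : ∀ {n} {ts ts' : Vec Term n} → ts ⟶ᵛ ts' → nfs ts ≡ nfs ts'
nf-resp-⟶ (proj-β i ts) = nfs-lookup ts i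
nf-resp-⟶ (comp-β f gs ts) = ≡.cong (reduceApp f) (sym (nfs-map-app gs ts))
nf-resp-⟶ (rec-0 g h ts) = refl
nf-resp-⟶ (rec-S g h s ts) = refl
nf-resp-⟶ (cong f st) = ≡.cong (reduceApp f) (nfs-resp-⟶ᵛ st)
nfs-resp-⟶ᵛ (here st) = ≡.cong (_∷ _) (nf-resp-⟶ st)
nfs-resp-⟶ᵛ (there st) = ≡.cong (_ ∷_) (nfs-resp-⟶ᵛ st)

nfF : Formula → Formula
nfF (t ≐ u) = nf t ≐ nf u
nfF falsum = falsum
nfF (and A B) = and (nfF A) (nfF B)
nfF (or A B) = or (nfF A) (nfF B)
nfF (imp A B) = imp (nfF A) (nfF B)
nfF (all x A) = all x (nfF A)
nfF (ex x A) = ex x (nfF A)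

nfF-⟶F* : ∀ A → A ⟶F* nfF A
nfF-⟶F* (t ≐ u) = gmap (_≐ u) eqL (nf-⟶* t) ◅◅ gmap (nf t ≐_) eqR (nf-⟶* u)
nfF-⟶F* falsum = ε
nfF-⟶F* (and A B) = gmap (λ X → and X B) andL (nfF-⟶F* A) ◅◅ gmap (and (nfF A)) andR (nfF-⟶F* B)
nfF-⟶F* (or A B) = gmap (λ X → or X B) orL (nfF-⟶F* A) ◅◅ gmap (or (nfF A)) orR (nfF-⟶F* B)
nfF-⟶F* (imp A B) = gmap (λ X → imp X B) impL (nfF-⟶F* A) ◅◅ gmap (imp (nfF A)) impR (nfF-⟶F* B)
nfF-⟶F* (all x A) = gmap (all x) allS (nfF-⟶F* A)
nfF-⟶F* (ex x A) = gmap (ex x) exS (nfF-⟶F* A)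

NormalF-nfF : ∀ A → NormalF (nfF A)
NormalF-nfF (t ≐ u) _ (eqL st) = Normal-nf t _ st
NormalF-nfF (t ≐ u) _ (eqR st) = Normal-nf u _ st
NormalF-nfF (and A B) _ (andL st) = NormalF-nfF A _ st
NormalF-nfF (and A B) _ (andR st) = NormalF-nfF B _ st
NormalF-nfF (or A B) _ (orL st) = NormalF-nfF A _ st
NormalF-nfF (or A B) _ (orR st) = NormalF-nfF B _ st
NormalF-nfF (imp A B) _ (impL st) = NormalF-nfF A _ st
NormalF-nfF (imp A B) _ (impR st) = NormalF-nfF B _ st
NormalF-nfF (all x A) _ (allS st) = NormalF-nfF A _ st
NormalF-nfF (ex x A) _ (exS st) = NormalF-nfF A _ st

nfF-resp-⟶F : ∀ {A B} → A ⟶F B → nfF A ≡ nfF B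
nfF-resp-⟶F (eqL st) = ≡.cong (_≐ _) (nf-resp-⟶ st)
nfF-resp-⟶F (eqR st) = ≡.cong (_ ≐_) (nf-resp-⟶ st)
nfF-resp-⟶F (andL st) = ≡.cong (λ X → and X _) (nfF-resp-⟶F st)
nfF-resp-⟶F (andR st) = ≡.cong (and _) (nfF-resp-⟶F st)
nfF-resp-⟶F (orL st) = ≡.cong (λ X → or X _) (nfF-resp-⟶F st)
nfF-resp-⟶F (orR st) = ≡.cong (or _) (nfF-resp-⟶F st)
nfF-resp-⟶F (impL st) = ≡.cong (λ X → imp X _) (nfF-resp-⟶F st)
nfF-resp-⟶F (impR st) = ≡.cong (imp _) (nfF-resp-⟶F st)
nfF-resp-⟶F (allS st) = ≡.cong (all _) (nfF-resp-⟶F st)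
nfF-resp-⟶F (exS st) = ≡.cong (ex _) (nfF-resp-⟶F st)

nfF-resp-⟶F* : ∀ {A B} → A ⟶F* B → nfF A ≡ nfF B
nfF-resp-⟶F* ε = refl
nfF-resp-⟶F* (st ◅ sts) = trans (nfF-resp-⟶F st) (nfF-resp-⟶F* sts)

≈⇒nfF≡ : ∀ {A B} → A ≈ B → nfF A ≡ nfF B
≈⇒nfF≡ (C , A⟶*C , B⟶*C , _) = begin
  nfF _ ≡⟨ nfF-resp-⟶F* A⟶*C ⟩
  nfF C ≡⟨ sym (nfF-resp-⟶F* B⟶*C) ⟩
  nfF _ ∎
  where open ≡.≡-Reasoning

nfF≡⇒≈ : ∀ {A B} → nfF A ≡ nfF B → A ≈ B
nfF≡⇒≈ {A} {B} eq = nfF A , nfF-⟶F* A , ≡.subst (B ⟶F*_) (sym eq) (nfF-⟶F* B) , NormalF-nfF A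

_≟ᴾ_  : ∀ {n} → DecidableEquality (PR n)
_≟ᴾᵛ_ : ∀ {n m} → DecidableEquality (Vec (PR n) m)
zeroᶠ ≟ᴾ zeroᶠ = yes refl
zeroᶠ ≟ᴾ projᶠ _ = no λ ()
zeroᶠ ≟ᴾ compᶠ _ _ = no λ ()
succᶠ ≟ᴾ succᶠ = yes refl
succᶠ ≟ᴾ projᶠ _ = no λ ()
succᶠ ≟ᴾ compᶠ _ _ = no λ ()
succᶠ ≟ᴾ recᶠ _ _ = no λ ()
projᶠ _ ≟ᴾ zeroᶠ = no λ ()
projᶠ _ ≟ᴾ succᶠ = no λ ()
projᶠ i ≟ᴾ projᶠ j with i Fin.≟ j
... | yes refl = yes refl
... | no i≢j = no λ { refl → i≢j refl }
projᶠ _ ≟ᴾ compᶠ _ _ = no λ ()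
projᶠ _ ≟ᴾ recᶠ _ _ = no λ ()
compᶠ _ _ ≟ᴾ zeroᶠ = no λ ()
compᶠ _ _ ≟ᴾ succᶠ = no λ ()
compᶠ _ _ ≟ᴾ projᶠ _ = no λ ()
compᶠ {m = m} f gs ≟ᴾ compᶠ {m = m'} f' gs' with m ℕ.≟ m'
... | no m≢m' = no λ { refl → m≢m' refl }
... | yes refl with f ≟ᴾ f' | gs ≟ᴾᵛ gs'
...   | yes refl | yes refl = yes refl
...   | no f≢f' | _ = no λ { refl → f≢f' refl }
...   | _ | no gs≢gs' = no λ { refl → gs≢gs' refl }
compᶠ _ _ ≟ᴾ recᶠ _ _ = no λ ()
recᶠ _ _ ≟ᴾ succᶠ = no λ ()
recᶠ _ _ ≟ᴾ projᶠ _ = no λ ()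
recᶠ _ _ ≟ᴾ compᶠ _ _ = no λ ()
recᶠ g h ≟ᴾ recᶠ g' h' with g ≟ᴾ g' | h ≟ᴾ h'
... | yes refl | yes refl = yes refl
... | no g≢g' | _ = no λ { refl → g≢g' refl }
... | _ | no h≢h' = no λ { refl → h≢h' refl }
[] ≟ᴾᵛ [] = yes refl
(f ∷ fs) ≟ᴾᵛ (g ∷ gs) with f ≟ᴾ g | fs ≟ᴾᵛ gs
... | yes refl | yes refl = yes refl
... | no f≢g | _ = no λ { refl → f≢g refl }
... | _ | no fs≢gs = no λ { refl → fs≢gs refl }

_≟ᵀ_  : DecidableEquality Term
_≟ᵀᵛ_ : ∀ {n} → DecidableEquality (Vec Term n)
var x ≟ᵀ var y with x ℕ.≟ y
... | yes refl = yes refl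
... | no x≢y = no λ { refl → x≢y refl }
var _ ≟ᵀ app _ _ = no λ ()
app _ _ ≟ᵀ var _ = no λ ()
app {n} f ts ≟ᵀ app {m} g us with n ℕ.≟ m
... | no n≢m = no λ { refl → n≢m refl }
... | yes refl with f ≟ᴾ g | ts ≟ᵀᵛ us
...   | yes refl | yes refl = yes refl
...   | no f≢g | _ = no λ { refl → f≢g refl }
...   | _ | no ts≢us = no λ { refl → ts≢us refl }
[] ≟ᵀᵛ [] = yes refl
(t ∷ ts) ≟ᵀᵛ (u ∷ us) with t ≟ᵀ u | ts ≟ᵀᵛ us
... | yes refl | yes refl = yes refl
... | no t≢u | _ = no λ { refl → t≢u refl }
... | _ | no ts≢us = no λ { refl → ts≢us refl }

≟-atomic : ∀ A B → Atomic B → Dec (A ≡ B)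
≟-atomic (t ≐ u) (t' ≐ u') _ with t ≟ᵀ t' | u ≟ᵀ u'
... | yes refl | yes refl = yes refl
... | no t≢t' | _ = no λ { refl → t≢t' refl }
... | _ | no u≢u' = no λ { refl → u≢u' refl }
≟-atomic (_ ≐ _) falsum _ = no λ ()
≟-atomic falsum falsum _ = yes refl
≟-atomic falsum (_ ≐ _) _ = no λ ()
≟-atomic (and _ _) (_ ≐ _) _ = no λ ()
≟-atomic (or _ _) (_ ≐ _) _ = no λ ()
≟-atomic (imp _ _) (_ ≐ _) _ = no λ ()
≟-atomic (all _ _) (_ ≐ _) _ = no λ ()
≟-atomic (ex _ _) (_ ≐ _) _ = no λ ()
≟-atomic (and _ _) falsum _ = no λ ()
≟-atomic (or _ _) falsum _ = no λ ()
≟-atomic (imp _ _) falsum _ = no λ ()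
≟-atomic (all _ _) falsum _ = no λ ()
≟-atomic (ex _ _) falsum _ = no λ ()

≟-simply-universal : ∀ A x Q → Atomic Q → Dec (A ≡ all x Q)
≟-simply-universal (all y A) x Q atomic with y ℕ.≟ x | ≟-atomic A Q atomic
... | yes refl | yes refl = yes refl
... | no y≢x | _ = no λ { refl → y≢x refl }
... | _ | no A≢Q = no λ { refl → A≢Q refl }
≟-simply-universal (_ ≐ _) x Q _ = no λ ()
≟-simply-universal falsum x Q _ = no λ ()
≟-simply-universal (and _ _) x Q _ = no λ ()
≟-simply-universal (or _ _) x Q _ = no λ ()
≟-simply-universal (imp _ _) x Q _ = no λ ()
≟-simply-universal (ex _ _) x Q _ = no λ ()

module _ {A : Set} where

  ‼-∷ʳ⁺ : ∀ (xs : List A) {y i z} → xs ‼ i ≡ just z → (xs ∷ʳ y) ‼ i ≡ just z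
  ‼-∷ʳ⁺ (x ∷ xs) {i = zero} e = e
  ‼-∷ʳ⁺ (x ∷ xs) {i = suc i} e = ‼-∷ʳ⁺ xs e

  ‼-∷ʳ-length : ∀ (xs : List A) y → (xs ∷ʳ y) ‼ length xs ≡ just y
  ‼-∷ʳ-length [] y = refl
  ‼-∷ʳ-length (x ∷ xs) y = ‼-∷ʳ-length xs y

  ‼-∷ʳ⁻ : ∀ (xs : List A) {y} i {z} → (xs ∷ʳ y) ‼ i ≡ just z →
    xs ‼ i ≡ just z ⊎ (i ≡ length xs × z ≡ y)
  ‼-∷ʳ⁻ [] zero refl = inj₂ (refl , refl)
  ‼-∷ʳ⁻ (x ∷ xs) zero e = inj₁ e
  ‼-∷ʳ⁻ (x ∷ xs) (suc i) e with ‼-∷ʳ⁻ xs i e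
  ... | inj₁ e' = inj₁ e'
  ... | inj₂ (i≡ , z≡) = inj₂ (≡.cong suc i≡ , z≡)

  ‼⇒< : ∀ (xs : List A) i {z} → xs ‼ i ≡ just z → i < length xs
  ‼⇒< (x ∷ xs) zero _ = s≤s z≤n
  ‼⇒< (x ∷ xs) (suc i) e = s≤s (‼⇒< xs i e)

  <⇒‼ : ∀ (xs : List A) i → i < length xs → ∃ λ z → xs ‼ i ≡ just z
  <⇒‼ (x ∷ xs) zero _ = x , refl
  <⇒‼ (x ∷ xs) (suc i) (s≤s i<n) = <⇒‼ xs i i<n

  ‼-lookup : ∀ (xs : List A) k → xs ‼ toℕ k ≡ just (List.lookup xs k)
  ‼-lookup (x ∷ xs) Fin.zero = refl
  ‼-lookup (x ∷ xs) (Fin.suc k) = ‼-lookup xs k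

  ‼-suc : ∀ (xs : List A) i → xs ‼ suc i ≡ List.drop 1 xs ‼ i
  ‼-suc [] i = refl
  ‼-suc (x ∷ xs) i = refl

  length-∷ʳ : ∀ (xs : List A) y → length (xs ∷ʳ y) ≡ suc (length xs)
  length-∷ʳ xs y = trans (length-++ xs) (+-comm (length xs) 1)

downward-induction : ∀ (Q : ℕ → Set) {m n} → Q n → (∀ {i} → m ≤ i → i < n → Q (suc i) → Q i) →
  ∀ {i} → m ≤ i → i ≤ n → Q i
downward-induction Q {m} {n} Qn step {i} m≤i i≤n = go (n ∸ i) (m+[n∸m]≡n i≤n) m≤i
  where
  go : ∀ r {i} → i + r ≡ n → m ≤ i → Q i
  go zero {i} eq _ = ≡.subst Q (trans (sym eq) (+-identityʳ i)) Qn
  go (suc r) {i} eq m≤i =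
    step m≤i (≡.subst (i <_) eq (m<m+n i (s≤s z≤n))) (go r (trans (sym (+-suc i r)) eq) (m≤n⇒m≤1+n m≤i))

chain-∷ : ∀ {d} (p : Pos d) → ∃ λ r → chain p ≡ (target p , 0) ∷ r
chain-∷ here = [] , refl
chain-∷ {d} (there k p) with chain-∷ p
... | r , eq rewrite eq = r ∷ʳ (d , toℕ k) , refl

length-chain : ∀ {d} (p : Pos d) → length (chain p) ≡ suc (length (chain p) ∸ 1)
length-chain p with chain-∷ p
... | _ , eq rewrite eq = refl

chain-last : ∀ {d} (p : Pos d) {i a k} → suc i ≡ length (chain p) →
  chain p ‼ i ≡ just (a , k) → a ≡ d
chain-last here {zero} _ refl = refl
chain-last {d} (there k p) {i} i+1≡len e with ‼-∷ʳ⁻ (chain p) i e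
... | inj₂ (_ , refl) = refl
... | inj₁ e' = ⊥-elim (<-irrefl i≡len (‼⇒< (chain p) i e'))
  where i≡len = suc-injective (trans i+1≡len (length-∷ʳ (chain p) (d , toℕ k)))

chain-premiss : ∀ {d} (p : Pos d) i {a ka b kb} → chain p ‼ i ≡ just (a , ka) →
  chain p ‼ suc i ≡ just (b , kb) → prems b ‼ kb ≡ just a
chain-premiss {d} (there k p) i {a} e e' with ‼-∷ʳ⁻ (chain p) (suc i) e' | ‼-∷ʳ⁻ (chain p) i e
... | inj₁ e'ₚ | inj₁ eₚ = chain-premiss p i eₚ e'ₚ
... | inj₁ e'ₚ | inj₂ (refl , _) = ⊥-elim (1+n≰n (<⇒≤ (‼⇒< (chain p) _ e'ₚ)))
... | inj₂ (i+1≡len , refl) | inj₂ (i≡len , _) = ⊥-elim (1+n≢n (trans i+1≡len (sym i≡len)))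
... | inj₂ (i+1≡len , refl) | inj₁ eₚ =
  ≡.subst (λ a' → prems d ‼ toℕ k ≡ just a') (sym (chain-last p i+1≡len eₚ)) (‼-lookup (prems d) k)

WF-prems : ∀ R d → WF R d → WFs R (prems d)
WF-prems R (hyp _ _) _ = tt
WF-prems R (atm _ _) (_ , ws) = ws
WF-prems R (andI _ _ _) (_ , w₁ , w₂) = w₁ , w₂ , tt
WF-prems R (andE₁ _ _) (_ , w) = w , tt
WF-prems R (andE₂ _ _) (_ , w) = w , tt
WF-prems R (orI₁ _ _) (_ , w) = w , tt
WF-prems R (orI₂ _ _) (_ , w) = w , tt
WF-prems R (orE _ _ _ _ _ _ _ _) (_ , _ , _ , w₁ , w₂ , w₃) = w₁ , w₂ , w₃ , tt
WF-prems R (impI _ _ _ _) (_ , w) = w , tt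
WF-prems R (impE _ _ _) (_ , w₁ , w₂) = w₁ , w₂ , tt
WF-prems R (allI _ _ _) (_ , _ , w) = w , tt
WF-prems R (allE _ _ _ _ _) (_ , _ , _ , w) = w , tt
WF-prems R (exI _ _ _ _ _) (_ , _ , _ , w) = w , tt
WF-prems R (exE _ _ _ _ _ _ _) (_ , _ , _ , _ , _ , _ , w₁ , w₂) = w₁ , w₂ , tt
WF-prems R (ind _ _ _ _ _ _ _) (_ , _ , _ , _ , _ , w₁ , w₂) = w₁ , w₂ , tt
WF-prems R (em1 _ _ _ _ _ _ _ _) (_ , _ , _ , _ , _ , w₁ , w₂) = w₁ , w₂ , tt

WFs-‼ : ∀ R (ds : List Der) k {a} → WFs R ds → ds ‼ k ≡ just a → WF R a
WFs-‼ R (d ∷ ds) zero (w , _) refl = w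
WFs-‼ R (d ∷ ds) (suc k) (_ , ws) e = WFs-‼ R ds k ws e

WF-chain : ∀ R {d} → WF R d → (p : Pos d) → ∀ i {a k} → chain p ‼ i ≡ just (a , k) → WF R a
WF-chain R w here zero refl = w
WF-chain R {d} w (there k p) i e with ‼-∷ʳ⁻ (chain p) i e
... | inj₁ e' = WF-chain R (WFs-‼ R (prems d) (toℕ k) (WF-prems R d w) (‼-lookup (prems d) k)) p i e'
... | inj₂ (_ , refl) = w

parent : ∀ {d} → Pos d → Pos d
parent here = here
parent (there k here) = here
parent (there k (there k' q)) = there k (parent (there k' q))

chain-there : ∀ {d} k (q : Pos (List.lookup (prems d) k)) → ∃ λ k₁ →
  chain (there {d} k q) ≡
    (target q , 0) ∷ (target (parent (there {d} k q)) , k₁) ∷ List.drop 1 (chain (parent (there {d} k q)))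
chain-there k here = toℕ k , refl
chain-there {d} k (there k' q)
  with chain-there {List.lookup (prems d) k} k' q | chain-∷ (parent (there {List.lookup (prems d) k} k' q))
... | k₁ , eq | r , eqₚ rewrite eq | eqₚ = k₁ , refl

Unbound : List (Der × ℕ) → Set
Unbound ch = ∀ i d k → 0 < i → ch ‼ i ≡ just (d , k) → binds d k ≡ nothing

closed-if-unbound : ∀ {D} → NoFreeVars D → (p : Pos D) → Unbound (chain p) → Closed (concl (target p))
closed-if-unbound nfv p unbound z z∈ with nfv p z z∈
... | i , d , k , 0<i , e , bound with trans (sym (unbound i d k 0<i e)) bound
... | ()

closed-below-target : ∀ {D} → NoFreeVars D → (p : Pos D) → Unbound (chain p) →
  ∀ {e k} → chain p ‼ 1 ≡ just (e , k) → Closed (concl e)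
closed-below-target {D} nfv (there k q) unbound {e} e₁ with chain-there {D} k q
... | _ , eq = ≡.subst (λ e' → Closed (concl e')) target≡e (closed-if-unbound nfv p↑ unbound-parent)
  where
  p↑ : Pos D
  p↑ = parent (there k q)
  target≡e : target p↑ ≡ e
  target≡e = ≡.cong proj₁ (just-injective (trans (sym (≡.cong (_‼ 1) eq)) e₁))
  unbound-parent : Unbound (chain p↑)
  unbound-parent (suc i) d k' _ e' = unbound (suc (suc i)) d k' (s≤s z≤n)
    (trans (≡.cong (_‼ suc (suc i)) eq) (trans (sym (‼-suc (chain p↑) i)) e'))

-- Shapes of formulas up to identification

-- Atomic or simply existential; closedness is dealt with separately.
SimpleForm : Formula → Set
SimpleForm (_ ≐ _) = ⊤
SimpleForm falsum = ⊤
SimpleForm (ex _ P) = Atomic P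
SimpleForm _ = ⊥

SimpleShape : Formula → Set
SimpleShape A = SimpleForm (nfF A)

UniversalShape : Formula → Set
UniversalShape A = ∃₂ λ z Q → nfF A ≡ all z Q

Atomic-nfF : ∀ {A} → Atomic A → Atomic (nfF A)
Atomic-nfF {_ ≐ _} _ = tt
Atomic-nfF {falsum} _ = tt

Atomic-nfF⁻ : ∀ {A} → Atomic (nfF A) → Atomic A
Atomic-nfF⁻ {_ ≐ _} _ = tt
Atomic-nfF⁻ {falsum} _ = tt

Atomic-substF : ∀ {A} t x → Atomic A → Atomic (substF A t x)
Atomic-substF {_ ≐ _} t x _ = tt
Atomic-substF {falsum} t x _ = tt

Atomic⇒SimpleForm : ∀ {A} → Atomic A → SimpleForm A
Atomic⇒SimpleForm {_ ≐ _} _ = tt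
Atomic⇒SimpleForm {falsum} _ = tt

Atomic-resp-≈ : ∀ {A B} → A ≈ B → Atomic B → Atomic (nfF A)
Atomic-resp-≈ {B = B} A≈B atomic = ≡.subst Atomic (sym (≈⇒nfF≡ A≈B)) (Atomic-nfF {B} atomic)

Simple⇒SimpleShape : ∀ {A} → Simple A → SimpleShape A
Simple⇒SimpleShape {A} (_ , inj₁ atomic) = Atomic⇒SimpleForm (Atomic-nfF {A} atomic)
Simple⇒SimpleShape (_ , inj₂ (_ , Q , refl , atomic)) = Atomic-nfF {Q} atomic

SimpleShape-resp-≈ : ∀ {A B} → A ≈ B → SimpleShape B → SimpleShape A
SimpleShape-resp-≈ A≈B = ≡.subst SimpleForm (sym (≈⇒nfF≡ A≈B))

SimpleShape⇒¬UniversalShape : ∀ {A} → SimpleShape A → ¬ UniversalShape A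
SimpleShape⇒¬UniversalShape s (_ , _ , eq) = ≡.subst SimpleForm eq s

em1-major-≈ : ∀ R {b a} → WF R b → IsEM1 b → prems b ‼ 0 ≡ just a → concl a ≈ concl b
em1-major-≈ R {em1 _ _ _ _ _ _ _ _} (_ , a≈C , _) _ refl = a≈C

atomic-premiss : ∀ R {b k a} → WF R b → IsAtomicRule b → prems b ‼ k ≡ just a → Atomic (nfF (concl a))
atomic-premiss R {atm C ds} {k} ((Ps , _ , ds≈Ps , _ , rule) , _) _ = go ds Ps k ds≈Ps (proj₁ (atomic R rule))
  where
  go : ∀ ds Ps k {a} → Pointwise _≈_ (List.map concl ds) Ps → All Atomic Ps → ds ‼ k ≡ just a →
       Atomic (nfF (concl a))
  go (d ∷ ds) (P ∷ Ps) zero (d≈P ∷ _) (atomic ∷ _) refl = Atomic-resp-≈ d≈P atomic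
  go (d ∷ ds) (P ∷ Ps) (suc k) (_ ∷ ds≈Ps) (_ ∷ atomics) e = go ds Ps k ds≈Ps atomics e

-- Only ∃I concludes a formula of simple shape, and its premiss is then atomic.
intro-premiss-SimpleShape : ∀ R {b k a} → WF R b → IsIntro b → prems b ‼ k ≡ just a →
  SimpleShape (concl b) → SimpleShape (concl a)
intro-premiss-SimpleShape R {andI _ _ _} (C≈ , _) _ _ s = ⊥-elim (≡.subst SimpleForm (≈⇒nfF≡ C≈) s)
intro-premiss-SimpleShape R {orI₁ _ _} ((_ , C≈) , _) _ _ s = ⊥-elim (≡.subst SimpleForm (≈⇒nfF≡ C≈) s)
intro-premiss-SimpleShape R {orI₂ _ _} ((_ , C≈) , _) _ _ s = ⊥-elim (≡.subst SimpleForm (≈⇒nfF≡ C≈) s)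
intro-premiss-SimpleShape R {impI _ _ _ _} (C≈ , _) _ _ s = ⊥-elim (≡.subst SimpleForm (≈⇒nfF≡ C≈) s)
intro-premiss-SimpleShape R {allI _ _ _} (C≈ , _) _ _ s = ⊥-elim (≡.subst SimpleForm (≈⇒nfF≡ C≈) s)
intro-premiss-SimpleShape R {exI _ x A t _} {zero} (C≈ , _ , a≈ , _) _ refl s =
  Atomic⇒SimpleForm (Atomic-resp-≈ a≈ (Atomic-substF {A} t x A-atomic))
  where A-atomic = Atomic-nfF⁻ {A} (≡.subst SimpleForm (≈⇒nfF≡ C≈) s)

intro-binds-nothing : ∀ R {b} k → WF R b → IsIntro b → SimpleShape (concl b) → binds b k ≡ nothing
intro-binds-nothing R {andI _ _ _} k _ _ _ = refl
intro-binds-nothing R {orI₁ _ _} k _ _ _ = refl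
intro-binds-nothing R {orI₂ _ _} k _ _ _ = refl
intro-binds-nothing R {impI _ _ _ _} k _ _ _ = refl
intro-binds-nothing R {allI _ _ _} k (C≈ , _) _ s = ⊥-elim (≡.subst SimpleForm (≈⇒nfF≡ C≈) s)
intro-binds-nothing R {exI _ _ _ _ _} k _ _ _ = refl

elim-binds-nothing : ∀ {b} → IsElim b → binds b 0 ≡ nothing
elim-binds-nothing {andE₁ _ _} _ = refl
elim-binds-nothing {andE₂ _ _} _ = refl
elim-binds-nothing {orE _ _ _ _ _ _ _ _} _ = refl
elim-binds-nothing {impE _ _ _} _ = refl
elim-binds-nothing {allE _ _ _ _ _} _ = refl
elim-binds-nothing {exE _ _ _ _ _ _ _} _ = refl

atomic-binds-nothing : ∀ {b} k → IsAtomicRule b → binds b k ≡ nothing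
atomic-binds-nothing {atm _ _} k _ = refl

em1-binds-nothing : ∀ {b} → IsEM1 b → binds b 0 ≡ nothing
em1-binds-nothing {em1 _ _ _ _ _ _ _ _} _ = refl

-- An elimination whose major premiss is simply universal is ∀E, concluding an instance of the body.
elim-simply-universal : ∀ R {b a z Q} → WF R b → IsElim b → prems b ‼ 0 ≡ just a →
  nfF (concl a) ≡ all z Q → Atomic Q → Atomic (concl b)
elim-simply-universal R {andE₁ C d} ((_ , d≈) , _) _ refl eq _ with trans (sym eq) (≈⇒nfF≡ d≈)
... | ()
elim-simply-universal R {andE₂ C d} ((_ , d≈) , _) _ refl eq _ with trans (sym eq) (≈⇒nfF≡ d≈)
... | ()
elim-simply-universal R {orE C _ _ _ _ d _ _} (d≈ , _) _ refl eq _ with trans (sym eq) (≈⇒nfF≡ d≈)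
... | ()
elim-simply-universal R {impE C d _} (d≈ , _) _ refl eq _ with trans (sym eq) (≈⇒nfF≡ d≈)
... | ()
elim-simply-universal R {exE C _ _ _ _ d _} (d≈ , _) _ refl eq _ with trans (sym eq) (≈⇒nfF≡ d≈)
... | ()
elim-simply-universal R {allE C x A t d} (d≈ , _ , C≈ , _) _ refl eq atomic with trans (sym eq) (≈⇒nfF≡ d≈)
... | refl = Atomic-nfF⁻ {C} (Atomic-resp-≈ C≈ (Atomic-substF {A} t x (Atomic-nfF⁻ {A} atomic)))

MajorIntro MajorAtomic : Der → ℕ → Set
MajorIntro b k = IsIntro b ⊎ (IsEM1 b × k ≡ 0)
MajorAtomic b k = IsAtomicRule b ⊎ (IsEM1 b × k ≡ 0)

premiss-SimpleShape : ∀ R {b k a} → WF R b → MajorIntro b k → prems b ‼ k ≡ just a →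
  SimpleShape (concl b) → SimpleShape (concl a)
premiss-SimpleShape R w (inj₁ intro) e = intro-premiss-SimpleShape R w intro e
premiss-SimpleShape R w (inj₂ (em , refl)) e = SimpleShape-resp-≈ (em1-major-≈ R w em e)

conclusion-UniversalShape : ∀ R {b k a} → WF R b → MajorAtomic b k → prems b ‼ k ≡ just a →
  UniversalShape (concl a) → UniversalShape (concl b)
conclusion-UniversalShape R w (inj₁ atomic) e (_ , _ , eq) = ⊥-elim (≡.subst Atomic eq (atomic-premiss R w atomic e))
conclusion-UniversalShape R w (inj₂ (em , refl)) e (z , Q , eq) =
  z , Q , trans (sym (≈⇒nfF≡ (em1-major-≈ R w em e))) eq

MajorAtomic-binds-nothing : ∀ {b k} → MajorAtomic b k → binds b k ≡ nothing
MajorAtomic-binds-nothing {k = k} (inj₁ atomic) = atomic-binds-nothing k atomic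
MajorAtomic-binds-nothing (inj₂ (em , refl)) = em1-binds-nothing em

MajorIntro-binds-nothing : ∀ R {b k} → WF R b → MajorIntro b k → SimpleShape (concl b) → binds b k ≡ nothing
MajorIntro-binds-nothing R {k = k} w (inj₁ intro) = intro-binds-nothing R k w intro
MajorIntro-binds-nothing R w (inj₂ (em , refl)) _ = em1-binds-nothing em

universal-assumption : ∀ {C P x y u v d e w B} → Kills (em1 C P x y u v d e) 0 w B → nfF B ≡ all x (nfF P)
universal-assumption (_ , refl , B≈) = ≈⇒nfF≡ B≈

universal-assumption? : ∀ {C P x y u v d e} w B → Atomic P → Dec (Kills (em1 C P x y u v d e) 0 w B)
universal-assumption? {C} {P} {x} {y} {u} {v} {d} {e} w B atomic
  with w ℕ.≟ u | ≟-simply-universal (nfF B) x (nfF P) (Atomic-nfF {P} atomic)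
... | yes refl | yes eq = yes (all x P , refl , nfF≡⇒≈ eq)
... | no w≢u | _ = no λ { (_ , refl , _) → w≢u refl }
... | yes refl | no ¬eq = no λ kills → ¬eq (universal-assumption {C} {P} {x} {y} {u} {v} {d} {e} kills)

-- Extending a branch of the major premiss through the final EM₁ instance

module Extension (R : AtomicRules) {C P x y u v d₁ d₂} (wf : WF R (em1 C P x y u v d₁ d₂))
  (p : Pos d₁) (leaf : IsLeaf (target p)) (principal : Principal (p , leaf))
  (nE nA nI : ℕ) (len : nE + nA + nI ≡ length (chain p) ∸ 1)
  (u' : ℕ) (B : Formula) (leaf-hyp : chain p ‼ 0 ≡ just (hyp u' B , 0)) (open-B : Undischarged (chain p) u' B)
  (elims : ∀ i d k → 0 < i → i ≤ nE → chain p ‼ i ≡ just (d , k) → IsElim d)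
  (atomics : ∀ i d k → nE < i → i ≤ nE + nA → chain p ‼ i ≡ just (d , k) → IsAtomicRule d ⊎ IsEM1 d)
  (intro-start : ∀ d k → chain p ‼ suc (nE + nA) ≡ just (d , k) → IsIntro d)
  (intros : ∀ i d k → nE + nA < i → chain p ‼ i ≡ just (d , k) → IsIntro d ⊎ IsEM1 d) where

  root : Der
  root = em1 C P x y u v d₁ d₂

  b⁺ : Branch root
  b⁺ = there Fin.zero p , leaf

  principal⁺ : Principal b⁺
  principal⁺ i d k 0<i e major with ‼-∷ʳ⁻ (chain p) i e
  ... | inj₁ e' = principal i d k 0<i e' major
  ... | inj₂ (_ , refl) = refl

  m n : ℕ
  m = nE + nA
  n = m + nI

  ch⁺ : List (Der × ℕ)
  ch⁺ = chainB b⁺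

  length-ch : length (chain p) ≡ suc n
  length-ch = trans (length-chain p) (≡.cong suc (sym len))

  length-ch⁺ : length ch⁺ ≡ suc (suc n)
  length-ch⁺ = trans (length-∷ʳ (chain p) (root , 0)) (≡.cong suc length-ch)

  entry-cases : ∀ i {z} → ch⁺ ‼ i ≡ just z → chain p ‼ i ≡ just z ⊎ (i ≡ suc n × z ≡ (root , 0))
  entry-cases i e with ‼-∷ʳ⁻ (chain p) i e
  ... | inj₁ e' = inj₁ e'
  ... | inj₂ (i≡ , z≡) = inj₂ (trans i≡ length-ch , z≡)

  entry-≤ : ∀ i {z} → chain p ‼ i ≡ just z → i ≤ n
  entry-≤ i e = ≤-pred (≡.subst (i <_) length-ch (‼⇒< (chain p) i e))

  entry : ∀ i → i ≤ suc n → ∃ λ z → ch⁺ ‼ i ≡ just z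
  entry i i≤ = <⇒‼ ch⁺ i (≡.subst (i <_) (sym length-ch⁺) (s≤s i≤))

  root-entry : ch⁺ ‼ suc n ≡ just (root , 0)
  root-entry = ≡.subst (λ j → ch⁺ ‼ j ≡ just (root , 0)) length-ch (‼-∷ʳ-length (chain p) (root , 0))

  leaf-hyp⁺ : ch⁺ ‼ 0 ≡ just (hyp u' B , 0)
  leaf-hyp⁺ = ‼-∷ʳ⁺ (chain p) leaf-hyp

  WF-entry : ∀ i {d k} → ch⁺ ‼ i ≡ just (d , k) → WF R d
  WF-entry = WF-chain R wf (there {root} Fin.zero p)

  premiss-entry : ∀ i {a ka b kb} → ch⁺ ‼ i ≡ just (a , ka) → ch⁺ ‼ suc i ≡ just (b , kb) →
                  prems b ‼ kb ≡ just a
  premiss-entry = chain-premiss (there {root} Fin.zero p)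

  m≤n : m ≤ n
  m≤n = m≤m+n m nI

  elims⁺ : ∀ i {d k} → 0 < i → i ≤ nE → ch⁺ ‼ i ≡ just (d , k) → IsElim d × k ≡ 0
  elims⁺ i 0<i i≤nE e with entry-cases i e
  ... | inj₁ e' = elim , principal i _ _ 0<i e' (inj₁ elim)
    where elim = elims i _ _ 0<i i≤nE e'
  ... | inj₂ (refl , _) = ⊥-elim (1+n≰n (≤-trans i≤nE (≤-trans (m≤m+n nE nA) m≤n)))

  atomics⁺ : ∀ i {d k} → nE < i → i ≤ m → ch⁺ ‼ i ≡ just (d , k) → MajorAtomic d k
  atomics⁺ i nE<i i≤m e with entry-cases i e
  ... | inj₂ (refl , _) = ⊥-elim (1+n≰n (≤-trans i≤m m≤n))
  ... | inj₁ e' with atomics i _ _ nE<i i≤m e'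
  ...   | inj₁ atomic = inj₁ atomic
  ...   | inj₂ em = inj₂ (em , principal i _ _ (≤-trans (s≤s z≤n) nE<i) e' (inj₂ em))

  intros⁺ : ∀ i {d k} → m < i → ch⁺ ‼ i ≡ just (d , k) → MajorIntro d k
  intros⁺ i m<i e with entry-cases i e
  ... | inj₂ (_ , refl) = inj₂ (tt , refl)
  ... | inj₁ e' with intros i _ _ m<i e'
  ...   | inj₁ intro = inj₁ intro
  ...   | inj₂ em = inj₂ (em , principal i _ _ (≤-trans (s≤s z≤n) m<i) e' (inj₂ em))

  module _ (¬kills : ¬ Kills root 0 u' B) where

    leaf⁺ : ∃₂ λ w A → ch⁺ ‼ 0 ≡ just (hyp w A , 0) × Undischarged ch⁺ w A
    leaf⁺ = u' , B , leaf-hyp⁺ , open-B⁺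
      where
      open-B⁺ : Undischarged ch⁺ u' B
      open-B⁺ i d k 0<i e with entry-cases i e
      ... | inj₁ e' = open-B i d k 0<i e'
      ... | inj₂ (_ , refl) = ¬kills

    elims-ONF : ∀ i d k → 0 < i → i ≤ nE → ch⁺ ‼ i ≡ just (d , k) → IsElim d
    elims-ONF i d k 0<i i≤nE e = proj₁ (elims⁺ i 0<i i≤nE e)

    intros-ONF : ∀ i d k → m < i → ch⁺ ‼ i ≡ just (d , k) → IsIntro d ⊎ IsEM1 d
    intros-ONF i d k m<i e = Sum.map₂ proj₁ (intros⁺ i m<i e)

    length-ch⁺∸1 : length ch⁺ ∸ 1 ≡ suc n
    length-ch⁺∸1 = ≡.cong (_∸ 1) length-ch⁺

    ONF⁺-atomic : nI ≡ 0 → OpenNormalForm b⁺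
    ONF⁺-atomic nI≡0 = nE , suc nA , 0 , sum , leaf⁺ , elims-ONF , atomics-ONF , intro-start-ONF , intros-ONF'
      where
      n≡m : n ≡ m
      n≡m = trans (≡.cong (m +_) nI≡0) (+-identityʳ m)
      nE+suc-nA≡suc-n : nE + suc nA ≡ suc n
      nE+suc-nA≡suc-n = trans (+-suc nE nA) (≡.cong suc (sym n≡m))
      sum : nE + suc nA + 0 ≡ length ch⁺ ∸ 1
      sum = trans (+-identityʳ _) (trans nE+suc-nA≡suc-n (sym length-ch⁺∸1))
      atomics-ONF : ∀ i d k → nE < i → i ≤ nE + suc nA → ch⁺ ‼ i ≡ just (d , k) →
                    IsAtomicRule d ⊎ IsEM1 d
      atomics-ONF i d k nE<i _ e with entry-cases i e
      ... | inj₁ e' = atomics i d k nE<i (≡.subst (i ≤_) n≡m (entry-≤ i e')) e'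
      ... | inj₂ (_ , refl) = inj₂ tt
      intro-start-ONF : ∀ d k → ch⁺ ‼ suc (nE + suc nA) ≡ just (d , k) → IsIntro d
      intro-start-ONF d k e =
        ⊥-elim (<-irrefl (≡.cong suc nE+suc-nA≡suc-n)
                         (≡.subst (suc (nE + suc nA) <_) length-ch⁺ (‼⇒< ch⁺ _ e)))
      intros-ONF' : ∀ i d k → nE + suc nA < i → ch⁺ ‼ i ≡ just (d , k) → IsIntro d ⊎ IsEM1 d
      intros-ONF' i d k lt = intros-ONF i d k (<-trans (n<1+n m) (≡.subst (_< i) (+-suc nE nA) lt))

    ONF⁺-intro : 0 < nI → OpenNormalForm b⁺
    ONF⁺-intro 0<nI = nE , nA , suc nI , sum , leaf⁺ , elims-ONF , atomics-ONF , intro-start-ONF , intros-ONF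
      where
      sum : nE + nA + suc nI ≡ length ch⁺ ∸ 1
      sum = trans (+-suc m nI) (sym length-ch⁺∸1)
      atomics-ONF : ∀ i d k → nE < i → i ≤ nE + nA → ch⁺ ‼ i ≡ just (d , k) → IsAtomicRule d ⊎ IsEM1 d
      atomics-ONF i d k nE<i i≤m e = Sum.map₂ proj₁ (atomics⁺ i nE<i i≤m e)
      intro-start-ONF : ∀ d k → ch⁺ ‼ suc (nE + nA) ≡ just (d , k) → IsIntro d
      intro-start-ONF d k e with entry-cases (suc m) e
      ... | inj₁ e' = intro-start d k e'
      ... | inj₂ (m+1≡n+1 , _) = ⊥-elim (<-irrefl (suc-injective m+1≡n+1) (m<m+n m 0<nI))

    ONF⁺ : OpenNormalForm b⁺
    ONF⁺ with nI ℕ.≟ 0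
    ... | yes nI≡0 = ONF⁺-atomic nI≡0
    ... | no nI≢0 = ONF⁺-intro (n≢0⇒n>0 nI≢0)

  universal-B : Kills root 0 u' B → nfF B ≡ all x (nfF P)
  universal-B = universal-assumption {C} {P} {x} {y} {u} {v} {d₁} {d₂}

  SimpleShape-from-root : Simple C → ∀ i {d k} → m ≤ i → ch⁺ ‼ i ≡ just (d , k) → SimpleShape (concl d)
  SimpleShape-from-root simple i m≤i e =
    downward-induction Q Q-root step m≤i (≤-pred (≡.subst (i <_) length-ch⁺ (‼⇒< ch⁺ i e))) e
    where
    Q : ℕ → Set
    Q i = ∀ {d k} → ch⁺ ‼ i ≡ just (d , k) → SimpleShape (concl d)
    Q-root : Q (suc n)
    Q-root e with trans (sym e) root-entry
    ... | refl = Simple⇒SimpleShape simple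
    step : ∀ {i} → m ≤ i → i < suc n → Q (suc i) → Q i
    step {i} m≤i i<n+1 Q-suc e with entry (suc i) i<n+1
    ... | _ , e' = premiss-SimpleShape R (WF-entry (suc i) e') (intros⁺ (suc i) (s≤s m≤i) e')
                                         (premiss-entry i e e') (Q-suc e')

  UniversalShape-from-leaf : Kills root 0 u' B → nE ≡ 0 →
                             ∀ i {d k} → i ≤ m → ch⁺ ‼ i ≡ just (d , k) → UniversalShape (concl d)
  UniversalShape-from-leaf kills _ zero _ e with trans (sym e) leaf-hyp⁺
  ... | refl = x , nfF P , universal-B kills
  UniversalShape-from-leaf kills nE≡0 (suc i) i<m e with entry i (≤-trans (<⇒≤ i<m) (m≤n⇒m≤1+n m≤n))
  ... | _ , e' = conclusion-UniversalShape R (WF-entry (suc i) e)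
    (atomics⁺ (suc i) (≡.subst (_< suc i) (sym nE≡0) (s≤s z≤n)) i<m e) (premiss-entry i e' e)
    (UniversalShape-from-leaf kills nE≡0 i (<⇒≤ i<m) e')

  -- The occurrence where the two parts meet can be neither of universal nor of simple shape.
  elims-nonempty : Simple C → Kills root 0 u' B → 0 < nE
  elims-nonempty simple kills with nE ℕ.≟ 0
  ... | no nE≢0 = n≢0⇒n>0 nE≢0
  ... | yes nE≡0 with entry m (m≤n⇒m≤1+n m≤n)
  ...   | _ , e = ⊥-elim (SimpleShape⇒¬UniversalShape (SimpleShape-from-root simple m ≤-refl e)
                                                       (UniversalShape-from-leaf kills nE≡0 m ≤-refl e))

  unbound⁺ : Simple C → Unbound ch⁺
  unbound⁺ simple i d k 0<i e with i ≤? nE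
  ... | yes i≤nE with elims⁺ i 0<i i≤nE e
  ...   | elim , refl = elim-binds-nothing elim
  unbound⁺ simple i d k 0<i e | no i≰nE with i ≤? m
  ... | yes i≤m = MajorAtomic-binds-nothing (atomics⁺ i (≰⇒> i≰nE) i≤m e)
  ... | no i≰m = MajorIntro-binds-nothing R (WF-entry i e) (intros⁺ i (≰⇒> i≰m) e)
                   (SimpleShape-from-root simple i (<⇒≤ (≰⇒> i≰m)) e)

  head-cut : NoFreeVars root → Simple C → Kills root 0 u' B → HasHeadCut b⁺
  head-cut nfv simple kills with entry 1 (s≤s z≤n) | entry n (n≤1+n n)
  ... | (e₁ , k₁) , entry₁ | (dₙ , kₙ) , entryₙ =
    n , root , 0 , dₙ , kₙ , root-entry , entryₙ ,
    inj₂ (inj₂ (inj₁ (tt , inj₂ (u' , B , leaf-hyp⁺ , refl , kills , undischarged-before-root ,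
                                 e₁ , k₁ , entry₁ , closed₁ , atomic₁))))
    where
    elim₁ : IsElim e₁ × k₁ ≡ 0
    elim₁ = elims⁺ 1 (s≤s z≤n) (elims-nonempty simple kills) entry₁
    major₁ : prems e₁ ‼ 0 ≡ just (hyp u' B)
    major₁ = ≡.subst (λ k → prems e₁ ‼ k ≡ just (hyp u' B)) (proj₂ elim₁) (premiss-entry 0 leaf-hyp⁺ entry₁)
    atomic₁ : Atomic (concl e₁)
    atomic₁ = elim-simply-universal R (WF-entry 1 entry₁) (proj₁ elim₁) major₁
                                    (universal-B kills) (Atomic-nfF {P} (proj₁ wf))
    closed₁ : Closed (concl e₁)
    closed₁ = closed-below-target nfv (there {root} Fin.zero p) (unbound⁺ simple) entry₁
    undischarged-before-root : ∀ j d k → 0 < j → j < suc n → ch⁺ ‼ j ≡ just (d , k) → ¬ Kills d k u' B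
    undischarged-before-root j d k 0<j j<n+1 e with entry-cases j e
    ... | inj₁ e' = open-B j d k 0<j e'
    ... | inj₂ (refl , _) = ⊥-elim (<-irrefl refl j<n+1)

  head-cut-or-ONF : NoFreeVars root → Simple C → HasHeadCut b⁺ ⊎ OpenNormalForm b⁺
  head-cut-or-ONF nfv simple with universal-assumption? {C} {P} {x} {y} {u} {v} {d₁} {d₂} u' B (proj₁ wf)
  ... | yes kills = inj₁ (head-cut nfv simple kills)
  ... | no ¬kills = inj₂ (ONF⁺ ¬kills)

lemma2 : (R : AtomicRules) (C P : Formula) (x y u v : ℕ) (d₁ d₂ : Der) →
    WF R (em1 C P x y u v d₁ d₂) →
    NoFreeVars (em1 C P x y u v d₁ d₂) →
    Simple C →
    Σ (Branch d₁) (λ b → Principal b × OpenNormalForm b) →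
    Σ (Branch (em1 C P x y u v d₁ d₂)) (λ b → Principal b × (HasHeadCut b ⊎ HasNonNormal b))
    ⊎ Σ (Branch (em1 C P x y u v d₁ d₂)) (λ b → Principal b × OpenNormalForm b)
lemma2 R C P x y u v d₁ d₂ wf nfv simple
  ((p , leaf) , principal , nE , nA , nI , len , (u' , B , leaf-hyp , open-B) , elims , atomics , intro-start , intros) =
  Sum.map (λ cut → b⁺ , principal⁺ , inj₁ cut) (λ onf → b⁺ , principal⁺ , onf) (head-cut-or-ONF nfv simple)
  where open Extension R wf p leaf principal nE nA nI len u' B leaf-hyp open-B elims atomics intro-start intros
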